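{- For all integers $0\leq \ell\leq m\leq n$ we have \[ \beta^*_{1,n}(P_{(\ell,m-\ell)})\leq \frac{1}{m^m}\;. \]
   Context: $K_n$ is the complete graph on $[n]=\{1,\dots,n\}$. A measure on the edges of $K_n$ is an assignment of a nonnegative real $\mu(e)$ to each edge $e$; its total mass is $w(\mu)=\sum_e\mu(e)$. For a subgraph $H'\subseteq K_n$, $\mu(H')=\prod_{e\in E(H')}\mu(e)$ (an empty product being $1$). For integers $k,\ell\geq 0$, $P_{(k,\ell)}$ is the disjoint union of a path with $k+1$ vertices ($k$ edges, "path of length $k$") and a path with $\ell+1$ vertices ("path of length $\ell$"). For $s,t\geq 0$, let $\mathbf{C}^*(P_{(s,t)},n)$ be the set of copies of $P_{(s,t)}$ in $K_n$ (vertex-disjoint paths) in which the path of length $s$ starts at vertex $n$ and the path of length $t$ starts at vertex $1$. Set $\beta^*(\mu;P_{(s,t)})=\sum_{P\in\mathbf{C}^*(P_{(s,t)},n)}\mu(P)$, and for $w>0$ let $\beta^*_{w,n}(P_{(s,t)})=\sup_\mu \beta^*(\mu;P_{(s,t)})$, the supremum over all measures $\mu$ on the edges of $K_n$ with $w(\mu)=w$.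
   Formalization: The measures μ on the edges of $K_n$ take only rational values rather than arbitrary nonnegative real ones. -}

module Defs where

open import Data.Nat as ℕ using (ℕ; zero; suc; _∸_; _^_; NonZero)
open import Data.Nat.Properties using (m^n≢0)
open import Data.Integer using (+_)
open import Data.Fin using (Fin; toℕ)
open import Data.Fin.Properties as FinP using ()
open import Data.Vec as Vec using (Vec; []; _∷_; head)
open import Data.List as List using (List; [_]; allFin; concatMap; map; foldr; _++_)
open import Data.Rational using (ℚ; 0ℚ; 1ℚ; _+_; _*_; _≤_; _/_)
open import Data.Product using (_×_; _,_)
open import Relation.Binary.PropositionalEquality using (_≡_)
open import Relation.Nullary using (does; _×-dec_)
open import Data.Bool using (if_then_else_)

-- Vertices of K_n: Fin n, where index i stands for vertex i+1.
-- So vertex 1 is the index with toℕ ≡ 0 and vertex n the index with toℕ ≡ n ∸ 1.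

-- A measure on the edges of K_n: a nonnegative, symmetric weight on pairs of
-- distinct vertices (the value μ i i is irrelevant: never used).
record Measure (n : ℕ) : Set where
  field
    μ        : Fin n → Fin n → ℚ
    nonneg   : ∀ i j → 0ℚ ≤ μ i j
    symmetric : ∀ i j → μ i j ≡ μ j i
open Measure public

sumℚ : List ℚ → ℚ
sumℚ = foldr _+_ 0ℚ

mass : ∀ {n} → Measure n → ℚ
mass {n} m = sumℚ (concatMap (λ i → concatMap (λ j →
  if does (toℕ i ℕ.<? toℕ j) then [ μ m i j ] else List.[]) (allFin n)) (allFin n))

allVecs : ∀ n k → List (Vec (Fin n) k)
allVecs n zero    = [ [] ]
allVecs n (suc k) = concatMap (λ i → map (i ∷_) (allVecs n k)) (allFin n)

pathWeight : ∀ {n k} → Measure n → Vec (Fin n) (suc k) → ℚ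
pathWeight m (v ∷ [])        = 1ℚ
pathWeight m (v ∷ w ∷ rest)  = μ m v w * pathWeight m (w ∷ rest)

-- Copies of P_(s,t) in C*(P_(s,t), n): a path (a_0,…,a_s) with a_0 = vertex n
-- and a path (b_0,…,b_t) with b_0 = vertex 1, all s+t+2 vertices distinct.
-- Such a copy (as a subgraph) corresponds to exactly one such pair of sequences.
IsCopy : ∀ {n} s t → Vec (Fin n) (suc s) → Vec (Fin n) (suc t) → Set
IsCopy {n} s t p q =
  (toℕ (head p) ≡ n ∸ 1) × (toℕ (head q) ≡ 0) × Unique (Vec.toList p ++ Vec.toList q)
  where open import Data.List.Relation.Unary.Unique.Propositional using (Unique)

isCopy? : ∀ {n} s t p q → Relation.Nullary.Dec (IsCopy {n} s t p q)
isCopy? {n} s t p q =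
  (toℕ (head p) ℕ.≟ (n ∸ 1)) ×-dec (toℕ (head q) ℕ.≟ 0) ×-dec unique? (Vec.toList p ++ Vec.toList q)
  where open import Data.List.Relation.Unary.Unique.DecPropositional FinP._≟_ using (unique?)

βstar : ∀ {n} → Measure n → (s t : ℕ) → ℚ
βstar {n} m s t = sumℚ (concatMap (λ p → map (λ q →
  if does (isCopy? s t p q) then pathWeight m p * pathWeight m q else 0ℚ)
  (allVecs n (suc t))) (allVecs n (suc s)))

-- m^m is nonzero (with 0^0 = 1).
powSelfNonZero : ∀ m → NonZero (m ^ m)
powSelfNonZero zero    = _
powSelfNonZero (suc k) = m^n≢0 (suc k) (suc k)

invPowSelf : ℕ → ℚ
invPowSelf m = (+ 1) / (m ^ m)
  where instance _ = powSelfNonZero m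

-- Generalise to a list F of forbidden vertices: let pathPairs F s t a b be the
-- μ-weight of pairs of vertex-disjoint paths of lengths s and t starting at a
-- and b and avoiding F, and massAvoiding F the mass of the edges with no
-- endpoint in F. Then k^k · pathPairs F s t a b ≤ (massAvoiding F)^k for
-- k = s + t, by induction on k. Removing the first edge {a, c} of the first path
-- bounds k^k · pathPairs F (s+1) t a b by x y^k, where x is the mass of the edges
-- from a to vertices outside F and y = massAvoiding (a ∷ F); since x + y is
-- massAvoiding F, the AM-GM inequality (k+1)^(k+1) x y^k ≤ k^k (x+y)^(k+1)
-- closes the induction. β* is the case F = [], a = n, b = 1.

module Submission where

open import Defs

-- Keeps the rational order out of scope of the final statement, whose _≤_ is ℕ's.
module _ where
  open import Algebra.Bundles using (CommutativeRing)
  open import Data.Bool using (Bool; true; false; if_then_else_; _∧_; not)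
  open import Data.Empty using (⊥-elim)
  open import Data.Fin as Fin using (Fin; toℕ)
  open import Data.Fin.Properties using (_≟_; <-cmp; suc-injective; toℕ-injective; toℕ-fromℕ)
  import Data.Integer.Base as ℤ
  import Data.Integer.Properties as ℤ
  open import Data.List using (List; []; _∷_; [_]; _++_; map; concatMap; allFin)
  open import Data.List.Properties using (map-cong; map-∘; map-concatMap; map-tabulate)
  open import Data.List.Membership.Propositional using (_∈_; _∉_)
  open import Data.List.Membership.Propositional.Properties using (∈-++⁺ˡ)
  import Data.List.Relation.Unary.All as All
  open import Data.List.Relation.Unary.AllPairs using (_∷_)
  open import Data.List.Relation.Unary.Unique.Propositional using (Unique)
  open import Data.Nat as ℕ using (ℕ; zero; suc)
  import Data.Nat.Properties as ℕ
  open import Data.Nat.Coprimality using (1-coprimeTo) renaming (sym to coprime-sym)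
  open import Data.Product using (_,_; proj₁; proj₂)
  open import Data.Rational
    using (ℚ; mkℚ; 0ℚ; 1ℚ; _+_; _*_; _-_; _≤_; _/_; Positive; nonNegative; nonPositive)
  open import Data.Rational.Properties hiding (_≟_; <-cmp)
  open import Data.Rational.Solver using (module +-*-Solver)
  open import Data.Sum using (inj₁; inj₂)
  open import Data.Vec using (Vec; _∷_; toList; head)
  open import Function using (_∘_; id)
  open import Function.Bundles using (mk⇔)
  open import Relation.Binary.Definitions using (tri<; tri≈; tri>)
  open import Relation.Binary.PropositionalEquality hiding ([_])
  open import Relation.Nullary using (¬_; yes; no; does)
  open import Relation.Nullary.Decidable using (dec-true; dec-false; does-⇔)
  open import Algebra.Properties.CommutativeSemiring.Exp
    (CommutativeRing.commutativeSemiring +-*-commutativeRing) using (_^_; ^-distrib-*)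
  open import Algebra.Properties.CommutativeSemigroup
    (CommutativeRing.*-commutativeSemigroup +-*-commutativeRing) using (x∙yz≈y∙xz)
  open +-*-Solver

  -- Rational arithmetic and the AM-GM inequality

  fromℕ : ℕ → ℚ
  fromℕ k = ℤ.+ k / 1

  fromℕ≡mkℚ : ∀ k → fromℕ k ≡ mkℚ (ℤ.+ k) 0 (coprime-sym (1-coprimeTo k))
  fromℕ≡mkℚ k = normalize-coprime (coprime-sym (1-coprimeTo k))

  fromℕ-+ : ∀ a b → fromℕ (a ℕ.+ b) ≡ fromℕ a + fromℕ b
  fromℕ-+ a b rewrite fromℕ≡mkℚ a | fromℕ≡mkℚ b =
    cong (_/ 1) (trans (ℤ.pos-+ a b)
                       (sym (cong₂ ℤ._+_ (ℤ.*-identityʳ (ℤ.+ a)) (ℤ.*-identityʳ (ℤ.+ b)))))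

  fromℕ-* : ∀ a b → fromℕ (a ℕ.* b) ≡ fromℕ a * fromℕ b
  fromℕ-* a b rewrite fromℕ≡mkℚ a | fromℕ≡mkℚ b = cong (_/ 1) (ℤ.pos-* a b)

  fromℕ-^ : ∀ a k → fromℕ (a ℕ.^ k) ≡ fromℕ a ^ k
  fromℕ-^ a zero    = refl
  fromℕ-^ a (suc k) = trans (fromℕ-* a (a ℕ.^ k)) (cong (fromℕ a *_) (fromℕ-^ a k))

  fromℕ-nonNeg : ∀ k → 0ℚ ≤ fromℕ k
  fromℕ-nonNeg k rewrite fromℕ≡mkℚ k = nonNegative⁻¹ _

  fromℕ-pos : ∀ k .{{_ : ℕ.NonZero k}} → Positive (fromℕ k)
  fromℕ-pos (suc k) rewrite fromℕ≡mkℚ (suc k) = _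

  powSelf-pos : ∀ k → Positive (fromℕ k ^ k)
  powSelf-pos k = subst Positive (fromℕ-^ k k) (fromℕ-pos (k ℕ.^ k) {{powSelfNonZero k}})

  1^k≡1 : ∀ k → 1ℚ ^ k ≡ 1ℚ
  1^k≡1 k = trans (sym (fromℕ-^ 1 k)) (cong fromℕ (ℕ.^-zeroˡ k))

  *-monoˡ-≤-0≤ : ∀ {r p q} → 0ℚ ≤ r → p ≤ q → r * p ≤ r * q
  *-monoˡ-≤-0≤ {r} 0≤r = *-monoˡ-≤-nonNeg r {{nonNegative 0≤r}}

  p≤p+q : ∀ {p q} → 0ℚ ≤ q → p ≤ p + q
  p≤p+q {p} 0≤q = ≤-trans (≤-reflexive (sym (+-identityʳ p))) (+-monoʳ-≤ p 0≤q)

  0≤* : ∀ {p q} → 0ℚ ≤ p → 0ℚ ≤ q → 0ℚ ≤ p * q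
  0≤* {p} 0≤p 0≤q = ≤-trans (≤-reflexive (sym (*-zeroʳ p))) (*-monoˡ-≤-0≤ 0≤p 0≤q)

  0≤^ : ∀ {p} k → 0ℚ ≤ p → 0ℚ ≤ p ^ k
  0≤^ zero    _   = nonNegative⁻¹ 1ℚ
  0≤^ (suc k) 0≤p = 0≤* 0≤p (0≤^ k 0≤p)

  0≤square : ∀ p → 0ℚ ≤ p * p
  0≤square p with ≤-total 0ℚ p
  ... | inj₁ 0≤p = 0≤* 0≤p 0≤p
  ... | inj₂ p≤0 = ≤-trans (≤-reflexive (sym (*-zeroʳ p))) (*-monoˡ-≤-nonPos p {{nonPositive p≤0}} p≤0)

  bernoulli : ∀ k {x d} → 0ℚ ≤ x → 0ℚ ≤ x + d →
              x ^ suc k + fromℕ (suc k) * x ^ k * d ≤ (x + d) ^ suc k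
  bernoulli zero {x} {d} _ _ = ≤-reflexive
    (solve 2 (λ x d → x :* con 1ℚ :+ con 1ℚ :* con 1ℚ :* d := (x :+ d) :* con 1ℚ) refl x d)
  bernoulli (suc k) {x} {d} 0≤x 0≤x+d = begin
    x ^ suc (suc k) + fromℕ (suc (suc k)) * x ^ suc k * d
      ≡⟨ cong (λ c → x ^ suc (suc k) + c * x ^ suc k * d) (fromℕ-+ 1 (suc k)) ⟩
    x * (x * xᵏ) + (1ℚ + K) * (x * xᵏ) * d
      ≤⟨ p≤p+q (0≤* (0≤* (fromℕ-nonNeg (suc k)) (0≤^ k 0≤x)) (0≤square d)) ⟩
    x * (x * xᵏ) + (1ℚ + K) * (x * xᵏ) * d + K * xᵏ * (d * d)
      ≡⟨ solve 4 (λ x d xᵏ K → x :* (x :* xᵏ) :+ (con 1ℚ :+ K) :* (x :* xᵏ) :* d :+ K :* xᵏ :* (d :* d)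
                            := (x :+ d) :* (x :* xᵏ :+ K :* xᵏ :* d)) refl x d xᵏ K ⟩
    (x + d) * (x ^ suc k + K * xᵏ * d)
      ≤⟨ *-monoˡ-≤-0≤ 0≤x+d (bernoulli k 0≤x 0≤x+d) ⟩
    (x + d) ^ suc (suc k) ∎
    where
    open ≤-Reasoning
    xᵏ = x ^ k
    K = fromℕ (suc k)

  amgm : ∀ k {x y} → 0ℚ ≤ x → 0ℚ ≤ y →
         fromℕ (suc k) ^ suc k * (x * y ^ k) ≤ fromℕ k ^ k * (x + y) ^ suc k
  amgm zero {x} {y} _ 0≤y = begin
    1ℚ * (x * 1ℚ) ≡⟨ solve 1 (λ x → con 1ℚ :* (x :* con 1ℚ) := x) refl x ⟩
    x             ≤⟨ p≤p+q 0≤y ⟩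
    x + y         ≡⟨ solve 2 (λ x y → x :+ y := con 1ℚ :* ((x :+ y) :* con 1ℚ)) refl x y ⟩
    1ℚ * ((x + y) * 1ℚ) ∎
    where open ≤-Reasoning
  amgm k@(suc _) {x} {y} 0≤x 0≤y = *-cancelˡ-≤-pos K {{fromℕ-pos k}} (begin
    K * (K₁ ^ suc k * (x * y ^ k))
      ≡⟨ solve 6 (λ K K₁ K₁ᵏ x y yᵏ → K :* ((K₁ :* K₁ᵏ) :* (x :* yᵏ))
                                 := (K₁ᵏ :* yᵏ) :* (K₁ :* y :+ K₁ :* (K :* x :- y)))
                 refl K K₁ (K₁ ^ k) x y (y ^ k) ⟩
    (K₁ ^ k * y ^ k) * (A + K₁ * D)
      ≡⟨ cong (_* (A + K₁ * D)) (sym (^-distrib-* K₁ y k)) ⟩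
    A ^ k * (A + K₁ * D)
      ≡⟨ solve 4 (λ Aᵏ A K₁ D → Aᵏ :* (A :+ K₁ :* D) := A :* Aᵏ :+ K₁ :* Aᵏ :* D)
                 refl (A ^ k) A K₁ D ⟩
    A ^ suc k + K₁ * A ^ k * D
      ≤⟨ bernoulli k 0≤A (subst (0ℚ ≤_) (sym A+D≡) (0≤* (fromℕ-nonNeg k) (+-mono-≤ 0≤x 0≤y))) ⟩
    (A + D) ^ suc k
      ≡⟨ cong (_^ suc k) A+D≡ ⟩
    (K * (x + y)) ^ suc k
      ≡⟨ ^-distrib-* K (x + y) (suc k) ⟩
    K * K ^ k * (x + y) ^ suc k
      ≡⟨ *-assoc K (K ^ k) ((x + y) ^ suc k) ⟩
    K * (K ^ k * (x + y) ^ suc k) ∎)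
    where
    open ≤-Reasoning
    K = fromℕ k
    K₁ = fromℕ (suc k)
    A = K₁ * y
    D = K * x - y
    0≤A : 0ℚ ≤ A
    0≤A = 0≤* (fromℕ-nonNeg (suc k)) 0≤y
    A+D≡ : A + D ≡ K * (x + y)
    A+D≡ rewrite fromℕ-+ 1 k =
      solve 3 (λ K x y → (con 1ℚ :+ K) :* y :+ (K :* x :- y) := K :* (x :+ y)) refl K x y

  amgm-≤ : ∀ k {x y z} → 0ℚ ≤ x → 0ℚ ≤ y → fromℕ k ^ k * z ≤ x * y ^ k →
           fromℕ (suc k) ^ suc k * z ≤ (x + y) ^ suc k
  amgm-≤ k {x} {y} {z} 0≤x 0≤y kᵏz≤xyᵏ = *-cancelˡ-≤-pos (fromℕ k ^ k) {{powSelf-pos k}} (begin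
    fromℕ k ^ k * (fromℕ (suc k) ^ suc k * z)
      ≡⟨ x∙yz≈y∙xz (fromℕ k ^ k) (fromℕ (suc k) ^ suc k) z ⟩
    fromℕ (suc k) ^ suc k * (fromℕ k ^ k * z)
      ≤⟨ *-monoˡ-≤-0≤ (0≤^ (suc k) (fromℕ-nonNeg (suc k))) kᵏz≤xyᵏ ⟩
    fromℕ (suc k) ^ suc k * (x * y ^ k)
      ≤⟨ amgm k 0≤x 0≤y ⟩
    fromℕ k ^ k * (x + y) ^ suc k ∎)
    where open ≤-Reasoning

  fromℕ*≤1⇒≤1/ : ∀ N .{{_ : ℕ.NonZero N}} {x} → fromℕ N * x ≤ 1ℚ → x ≤ ℤ.+ 1 / N
  fromℕ*≤1⇒≤1/ N@(suc _) {x} Nx≤1 = begin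
    x                  ≡⟨ sym (*-identityˡ x) ⟩
    1ℚ * x             ≡⟨ cong (_* x) (sym r*N≡1) ⟩
    r * fromℕ N * x    ≡⟨ *-assoc r (fromℕ N) x ⟩
    r * (fromℕ N * x)  ≤⟨ *-monoˡ-≤-0≤ (nonNegative⁻¹ r {{normalize-nonNeg 1 N}}) Nx≤1 ⟩
    r * 1ℚ             ≡⟨ *-identityʳ r ⟩
    r                  ∎
    where
    open ≤-Reasoning
    r = ℤ.+ 1 / N
    r*N≡1 : r * fromℕ N ≡ 1ℚ
    r*N≡1 = trans (cong₂ _*_ (normalize-coprime (1-coprimeTo N)) (fromℕ≡mkℚ N))
                  (*-inverseˡ (mkℚ (ℤ.+ N) 0 (coprime-sym (1-coprimeTo N))))

  -- Finite sums over lists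

  variable
    A B : Set

  keepIf : Bool → ℚ → ℚ
  keepIf b x = if b then x else 0ℚ

  keepIf-nonNeg : ∀ b {x} → 0ℚ ≤ x → 0ℚ ≤ keepIf b x
  keepIf-nonNeg true  0≤x = 0≤x
  keepIf-nonNeg false _   = ≤-refl

  keepIf-*ˡ : ∀ b c x → keepIf b (c * x) ≡ c * keepIf b x
  keepIf-*ˡ true  c x = refl
  keepIf-*ˡ false c x = sym (*-zeroʳ c)

  Σ : List A → (A → ℚ) → ℚ
  Σ xs f = sumℚ (map f xs)

  sumℚ-++ : ∀ xs ys → sumℚ (xs ++ ys) ≡ sumℚ xs + sumℚ ys
  sumℚ-++ []       ys = sym (+-identityˡ (sumℚ ys))
  sumℚ-++ (x ∷ xs) ys = trans (cong (x +_) (sumℚ-++ xs ys)) (sym (+-assoc x (sumℚ xs) (sumℚ ys)))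

  sumℚ-concatMap : ∀ (g : A → List ℚ) xs → sumℚ (concatMap g xs) ≡ Σ xs (sumℚ ∘ g)
  sumℚ-concatMap g []       = refl
  sumℚ-concatMap g (x ∷ xs) = trans (sumℚ-++ (g x) _) (cong (sumℚ (g x) +_) (sumℚ-concatMap g xs))

  Σ-cong : ∀ {f g : A → ℚ} → (∀ x → f x ≡ g x) → ∀ xs → Σ xs f ≡ Σ xs g
  Σ-cong f≗g xs = cong sumℚ (map-cong f≗g xs)

  Σ-map : ∀ (f : B → ℚ) (h : A → B) xs → Σ (map h xs) f ≡ Σ xs (f ∘ h)
  Σ-map f h xs = cong sumℚ (sym (map-∘ xs))

  Σ-concatMap : ∀ (f : B → ℚ) (g : A → List B) xs → Σ (concatMap g xs) f ≡ Σ xs (λ x → Σ (g x) f)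
  Σ-concatMap f g xs = trans (cong sumℚ (map-concatMap f g xs)) (sumℚ-concatMap (map f ∘ g) xs)

  Σ-+ : ∀ (f g : A → ℚ) xs → Σ xs (λ x → f x + g x) ≡ Σ xs f + Σ xs g
  Σ-+ f g []       = refl
  Σ-+ f g (x ∷ xs) = trans (cong (f x + g x +_) (Σ-+ f g xs))
    (solve 4 (λ a b c d → a :+ b :+ (c :+ d) := a :+ c :+ (b :+ d)) refl (f x) (g x) (Σ xs f) (Σ xs g))

  Σ-+₃ : ∀ (f g h : A → ℚ) xs → Σ xs (λ x → f x + g x + h x) ≡ Σ xs f + Σ xs g + Σ xs h
  Σ-+₃ f g h xs = trans (Σ-+ (λ x → f x + g x) h xs) (cong (_+ Σ xs h) (Σ-+ f g xs))

  Σ-*ˡ : ∀ c (f : A → ℚ) xs → Σ xs (λ x → c * f x) ≡ c * Σ xs f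
  Σ-*ˡ c f []       = sym (*-zeroʳ c)
  Σ-*ˡ c f (x ∷ xs) = trans (cong (c * f x +_) (Σ-*ˡ c f xs)) (sym (*-distribˡ-+ c (f x) (Σ xs f)))

  Σ-*ʳ : ∀ c (f : A → ℚ) xs → Σ xs (λ x → f x * c) ≡ Σ xs f * c
  Σ-*ʳ c f xs = trans (Σ-cong (λ x → *-comm (f x) c) xs) (trans (Σ-*ˡ c f xs) (*-comm c (Σ xs f)))

  Σ-zero : ∀ {f : A → ℚ} → (∀ x → f x ≡ 0ℚ) → ∀ xs → Σ xs f ≡ 0ℚ
  Σ-zero f≗0 []       = refl
  Σ-zero f≗0 (x ∷ xs) rewrite f≗0 x | Σ-zero f≗0 xs = refl

  Σ-mono-≤ : ∀ {f g : A → ℚ} → (∀ x → f x ≤ g x) → ∀ xs → Σ xs f ≤ Σ xs g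
  Σ-mono-≤ f≤g []       = ≤-refl
  Σ-mono-≤ f≤g (x ∷ xs) = +-mono-≤ (f≤g x) (Σ-mono-≤ f≤g xs)

  Σ-nonNeg : ∀ {f : A → ℚ} → (∀ x → 0ℚ ≤ f x) → ∀ xs → 0ℚ ≤ Σ xs f
  Σ-nonNeg 0≤f xs = ≤-trans (≤-reflexive (sym (Σ-zero (λ _ → refl) xs))) (Σ-mono-≤ 0≤f xs)

  Σ-keepIf : ∀ b (f : A → ℚ) xs → Σ xs (λ x → keepIf b (f x)) ≡ keepIf b (Σ xs f)
  Σ-keepIf true  f xs = refl
  Σ-keepIf false f xs = Σ-zero (λ _ → refl) xs

  Σ-swap : ∀ (f : A → B → ℚ) xs ys → Σ xs (λ x → Σ ys (f x)) ≡ Σ ys (λ y → Σ xs (λ x → f x y))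
  Σ-swap f []       ys = sym (Σ-zero (λ _ → refl) ys)
  Σ-swap f (x ∷ xs) ys =
    trans (cong (Σ ys (f x) +_) (Σ-swap f xs ys)) (sym (Σ-+ (f x) (λ y → Σ xs (λ x → f x y)) ys))

  Σ-allFin-suc : ∀ {n} (f : Fin (suc n) → ℚ) →
                 Σ (allFin (suc n)) f ≡ f Fin.zero + Σ (allFin n) (f ∘ Fin.suc)
  Σ-allFin-suc f = cong (λ xs → f Fin.zero + sumℚ xs)
    (trans (map-tabulate Fin.suc f) (sym (map-tabulate id (f ∘ Fin.suc))))

  Σ-allFin-single : ∀ {n} (a : Fin n) (f : Fin n → ℚ) →
                    (∀ i → i ≢ a → f i ≡ 0ℚ) → Σ (allFin n) f ≡ f a
  Σ-allFin-single {suc n} Fin.zero f vanish = begin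
    Σ (allFin (suc n)) f
      ≡⟨ Σ-allFin-suc f ⟩
    f Fin.zero + Σ (allFin n) (f ∘ Fin.suc)
      ≡⟨ cong (f Fin.zero +_) (Σ-zero (λ i → vanish (Fin.suc i) λ ()) (allFin n)) ⟩
    f Fin.zero + 0ℚ
      ≡⟨ +-identityʳ (f Fin.zero) ⟩
    f Fin.zero ∎
    where open ≡-Reasoning
  Σ-allFin-single {suc n} (Fin.suc a) f vanish = begin
    Σ (allFin (suc n)) f
      ≡⟨ Σ-allFin-suc f ⟩
    f Fin.zero + Σ (allFin n) (f ∘ Fin.suc)
      ≡⟨ cong₂ _+_ (vanish Fin.zero λ ()) (Σ-allFin-single a (f ∘ Fin.suc) vanish-suc) ⟩
    0ℚ + f (Fin.suc a)
      ≡⟨ +-identityˡ (f (Fin.suc a)) ⟩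
    f (Fin.suc a) ∎
    where
    open ≡-Reasoning
    vanish-suc : ∀ i → i ≢ a → f (Fin.suc i) ≡ 0ℚ
    vanish-suc i i≢a = vanish (Fin.suc i) (i≢a ∘ suc-injective)

  Σ-allFin-keepIf-≟ : ∀ {n} (a : Fin n) (f : Fin n → ℚ) →
                      Σ (allFin n) (λ i → keepIf (does (i ≟ a)) (f i)) ≡ f a
  Σ-allFin-keepIf-≟ a f = trans
    (Σ-allFin-single a _ (λ i i≢a → cong (λ b → keepIf b (f i)) (dec-false (i ≟ a) i≢a)))
    (cong (λ b → keepIf b (f a)) (dec-true (a ≟ a) refl))

  Σ-allVecs-suc : ∀ {n k} (f : Vec (Fin n) (suc k) → ℚ) →
                  Σ (allVecs n (suc k)) f ≡ Σ (allFin n) (λ i → Σ (allVecs n k) (λ p → f (i ∷ p)))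
  Σ-allVecs-suc {n} {k} f =
    trans (Σ-concatMap f _ (allFin n)) (Σ-cong (λ i → Σ-map f (i ∷_) (allVecs n k)) (allFin n))

  sumℚ-ifSingleton : ∀ b x → sumℚ (if b then [ x ] else []) ≡ keepIf (b ∧ true) x
  sumℚ-ifSingleton true  x = +-identityʳ x
  sumℚ-ifSingleton false x = refl

  -- Pairs of disjoint paths avoiding a vertex set

  module _ {n : ℕ} (ν : Measure n) where
    open import Data.List.Relation.Unary.Unique.DecPropositional (_≟_ {n}) using (unique?)
    open import Data.List.Membership.DecPropositional (_≟_ {n}) using (_∈?_)
    open import Data.List.Relation.Binary.Permutation.Setoid (setoid (Fin n)) using (_↭_; ↭-sym)
    open import Data.List.Relation.Binary.Permutation.Setoid.Properties (setoid (Fin n))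
      using (Unique-resp-↭; ↭-shift; ++⁺ˡ; ++-comm)

    does-unique?-↭ : ∀ {L L′} → L ↭ L′ → does (unique? L) ≡ does (unique? L′)
    does-unique?-↭ L↭L′ =
      does-⇔ (mk⇔ (Unique-resp-↭ L↭L′) (Unique-resp-↭ (↭-sym L↭L′))) (unique? _) (unique? _)

    pairWeight : ∀ {s t} → List (Fin n) → Vec (Fin n) (suc s) → Vec (Fin n) (suc t) → ℚ
    pairWeight F P Q = keepIf (does (unique? (F ++ toList P ++ toList Q))) (pathWeight ν P * pathWeight ν Q)

    pathPairs : List (Fin n) → ℕ → ℕ → Fin n → Fin n → ℚ
    pathPairs F s t a b = Σ (allVecs n s) λ p → Σ (allVecs n t) λ q → pairWeight F (a ∷ p) (b ∷ q)

    ∈⇒¬Unique : ∀ {a F} L → a ∈ F → ¬ Unique (F ++ a ∷ L)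
    ∈⇒¬Unique {a} {F} L a∈F u with Unique-resp-↭ (↭-shift F L) u
    ... | a∉F++L ∷ _ = All.lookup a∉F++L (∈-++⁺ˡ a∈F) refl

    pathPairs-forbidden : ∀ {F a} s t b → a ∈ F → pathPairs F s t a b ≡ 0ℚ
    pathPairs-forbidden {F} {a} s t b a∈F = Σ-zero (λ p → Σ-zero (λ q →
      cong (λ u → keepIf u (pathWeight ν (a ∷ p) * pathWeight ν (b ∷ q)))
           (dec-false (unique? _) (∈⇒¬Unique (toList p ++ toList (b ∷ q)) a∈F))) (allVecs n t)) (allVecs n s)

    pairWeight-swap : ∀ {s t} F (P : Vec (Fin n) (suc s)) (Q : Vec (Fin n) (suc t)) →
                      pairWeight F P Q ≡ pairWeight F Q P
    pairWeight-swap F P Q = cong₂ keepIf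
      (does-unique?-↭ (++⁺ˡ F (++-comm (toList P) (toList Q))))
      (*-comm (pathWeight ν P) (pathWeight ν Q))

    pathPairs-swap : ∀ F s t a b → pathPairs F s t a b ≡ pathPairs F t s b a
    pathPairs-swap F s t a b = trans (Σ-swap _ (allVecs n s) (allVecs n t))
      (Σ-cong (λ q → Σ-cong (λ p → pairWeight-swap F (a ∷ p) (b ∷ q)) (allVecs n s)) (allVecs n t))

    pairWeight-∷ : ∀ {s t} F a c (p : Vec (Fin n) s) (Q : Vec (Fin n) (suc t)) →
                   pairWeight F (a ∷ c ∷ p) Q ≡ μ ν a c * pairWeight (a ∷ F) (c ∷ p) Q
    pairWeight-∷ F a c p Q = trans
      (cong₂ keepIf (does-unique?-↭ (↭-shift F L))
                    (*-assoc (μ ν a c) (pathWeight ν (c ∷ p)) (pathWeight ν Q)))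
      (keepIf-*ˡ (does (unique? (a ∷ F ++ L))) (μ ν a c) _)
      where L = toList (c ∷ p) ++ toList Q

    pathPairs-suc : ∀ F s t a b →
                    pathPairs F (suc s) t a b ≡ Σ (allFin n) (λ c → μ ν a c * pathPairs (a ∷ F) s t c b)
    pathPairs-suc F s t a b = begin
      pathPairs F (suc s) t a b
        ≡⟨ Σ-allVecs-suc (λ P → Σ Qs λ q → pairWeight F (a ∷ P) (b ∷ q)) ⟩
      Σ (allFin n) (λ c → Σ Ps λ p → Σ Qs λ q → pairWeight F (a ∷ c ∷ p) (b ∷ q))
        ≡⟨ Σ-cong (λ c → Σ-cong (λ p → Σ-cong (λ q → pairWeight-∷ F a c p (b ∷ q)) Qs) Ps) (allFin n) ⟩
      Σ (allFin n) (λ c → Σ Ps λ p → Σ Qs λ q → μ ν a c * pairWeight (a ∷ F) (c ∷ p) (b ∷ q))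
        ≡⟨ Σ-cong (λ c → trans (Σ-cong (λ p → Σ-*ˡ (μ ν a c) _ Qs) Ps) (Σ-*ˡ (μ ν a c) _ Ps)) (allFin n) ⟩
      Σ (allFin n) (λ c → μ ν a c * pathPairs (a ∷ F) s t c b) ∎
      where
      open ≡-Reasoning
      Ps = allVecs n s
      Qs = allVecs n t

    live : List (Fin n) → Fin n → Bool
    live F i = not (does (i ∈? F))

    live-∉ : ∀ {F i} → i ∉ F → live F i ≡ true
    live-∉ {F} {i} i∉F = cong not (dec-false (i ∈? F) i∉F)

    pathPairs-live : ∀ F s t c b x → x * pathPairs F s t c b ≡ keepIf (live F c) x * pathPairs F s t c b
    pathPairs-live F s t c b x with c ∈? F
    ... | no  _   = refl
    ... | yes c∈F = begin
      x * pathPairs F s t c b   ≡⟨ cong (x *_) P≡0 ⟩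
      x * 0ℚ                    ≡⟨ *-zeroʳ x ⟩
      0ℚ                        ≡⟨ sym (*-zeroˡ (pathPairs F s t c b)) ⟩
      0ℚ * pathPairs F s t c b  ∎
      where
      open ≡-Reasoning
      P≡0 = pathPairs-forbidden s t b c∈F

    _<ᵇ_ : Fin n → Fin n → Bool
    i <ᵇ j = does (toℕ i ℕ.<? toℕ j)

    <ᵇ-irrefl : ∀ i → (i <ᵇ i) ≡ false
    <ᵇ-irrefl i = dec-false (toℕ i ℕ.<? toℕ i) (ℕ.n≮n (toℕ i))

    massAvoiding : List (Fin n) → ℚ
    massAvoiding F =
      Σ (allFin n) λ i → Σ (allFin n) λ j → keepIf (i <ᵇ j ∧ live F i ∧ live F j) (μ ν i j)

    degreeAvoiding : List (Fin n) → Fin n → ℚ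
    degreeAvoiding F a = Σ (allFin n) λ c → keepIf (live (a ∷ F) c) (μ ν a c)

    massAvoiding-nonNeg : ∀ F → 0ℚ ≤ massAvoiding F
    massAvoiding-nonNeg F =
      Σ-nonNeg (λ i → Σ-nonNeg (λ j → keepIf-nonNeg _ (nonneg ν i j)) (allFin n)) (allFin n)

    degreeAvoiding-nonNeg : ∀ F a → 0ℚ ≤ degreeAvoiding F a
    degreeAvoiding-nonNeg F a = Σ-nonNeg (λ c → keepIf-nonNeg _ (nonneg ν a c)) (allFin n)

    mass≡massAvoiding[] : mass ν ≡ massAvoiding []
    mass≡massAvoiding[] = trans (sumℚ-concatMap _ (allFin n)) (Σ-cong (λ i →
      trans (sumℚ-concatMap _ (allFin n)) (Σ-cong (λ j → sumℚ-ifSingleton (i <ᵇ j) (μ ν i j)) (allFin n)))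
      (allFin n))

    module _ {F : List (Fin n)} {a : Fin n} (a∉F : a ∉ F) where

      edgeAbove edgeBelow : Fin n → ℚ
      edgeAbove j = keepIf (a <ᵇ j ∧ live F j) (μ ν a j)
      edgeBelow i = keepIf (i <ᵇ a ∧ live F i) (μ ν i a)

      edge-split : ∀ i j →
        keepIf (i <ᵇ j ∧ live F i ∧ live F j) (μ ν i j)
          ≡ keepIf (i <ᵇ j ∧ live (a ∷ F) i ∧ live (a ∷ F) j) (μ ν i j)
            + keepIf (does (i ≟ a)) (edgeAbove j) + keepIf (does (j ≟ a)) (edgeBelow i)
      edge-split i j with i ≟ a | j ≟ a
      ... | yes refl | yes refl rewrite <ᵇ-irrefl a = refl
      ... | yes refl | no _     = from-a (a <ᵇ j) (live F j) (live-∉ a∉F)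
        where
        from-a : ∀ b c {d} → d ≡ true → keepIf (b ∧ d ∧ c) (μ ν a j)
                 ≡ keepIf (b ∧ false) (μ ν a j) + keepIf (b ∧ c) (μ ν a j) + 0ℚ
        from-a false c refl = refl
        from-a true  c refl = sym (trans (+-identityʳ _) (+-identityˡ _))
      ... | no _     | yes refl = to-a (i <ᵇ a) (live F i) (live-∉ a∉F)
        where
        to-a : ∀ b c {d} → d ≡ true → keepIf (b ∧ c ∧ d) (μ ν i a)
               ≡ keepIf (b ∧ c ∧ false) (μ ν i a) + 0ℚ + keepIf (b ∧ c) (μ ν i a)
        to-a false c     refl = refl
        to-a true  false refl = refl
        to-a true  true  refl = sym (+-identityˡ _)
      ... | no _     | no _     = sym (trans (+-identityʳ _) (+-identityʳ _))

      edgeAbove-< : ∀ {c} → a Fin.< c → edgeAbove c ≡ keepIf (live F c) (μ ν a c)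
      edgeAbove-< {c} a<c =
        cong (λ u → keepIf (u ∧ live F c) (μ ν a c)) (dec-true (toℕ a ℕ.<? toℕ c) a<c)

      edgeAbove-≮ : ∀ {c} → ¬ a Fin.< c → edgeAbove c ≡ 0ℚ
      edgeAbove-≮ {c} a≮c =
        cong (λ u → keepIf (u ∧ live F c) (μ ν a c)) (dec-false (toℕ a ℕ.<? toℕ c) a≮c)

      edgeBelow-< : ∀ {c} → c Fin.< a → edgeBelow c ≡ keepIf (live F c) (μ ν c a)
      edgeBelow-< {c} c<a =
        cong (λ u → keepIf (u ∧ live F c) (μ ν c a)) (dec-true (toℕ c ℕ.<? toℕ a) c<a)

      edgeBelow-≮ : ∀ {c} → ¬ c Fin.< a → edgeBelow c ≡ 0ℚ
      edgeBelow-≮ {c} c≮a =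
        cong (λ u → keepIf (u ∧ live F c) (μ ν c a)) (dec-false (toℕ c ℕ.<? toℕ a) c≮a)

      degree-split : ∀ c → keepIf (live (a ∷ F) c) (μ ν a c) ≡ edgeAbove c + edgeBelow c
      degree-split c with c ≟ a
      ... | yes refl = sym (cong₂ _+_ (edgeAbove-≮ (ℕ.n≮n _)) (edgeBelow-≮ (ℕ.n≮n _)))
      ... | no c≢a with <-cmp a c
      ...   | tri< a<c _ c≮a = sym (trans (cong₂ _+_ (edgeAbove-< a<c) (edgeBelow-≮ c≮a)) (+-identityʳ _))
      ...   | tri> a≮c _ c<a = sym (trans (cong₂ _+_ (edgeAbove-≮ a≮c) (edgeBelow-< c<a))
                                          (trans (+-identityˡ _) (cong (keepIf (live F c)) (symmetric ν c a))))
      ...   | tri≈ _ a≡c _ = ⊥-elim (c≢a (sym a≡c))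

      massAvoiding-∷ : massAvoiding F ≡ degreeAvoiding F a + massAvoiding (a ∷ F)
      massAvoiding-∷ = begin
        massAvoiding F
          ≡⟨ Σ-cong (λ i → Σ-cong (edge-split i) (allFin n)) (allFin n) ⟩
        Σ (allFin n) (λ i → Σ (allFin n) λ j → rest i j + above i j + below i j)
          ≡⟨ Σ-cong (λ i → Σ-+₃ (rest i) (above i) (below i) (allFin n)) (allFin n) ⟩
        Σ (allFin n) (λ i → Σ (allFin n) (rest i) + Σ (allFin n) (above i) + Σ (allFin n) (below i))
          ≡⟨ Σ-+₃ _ _ _ (allFin n) ⟩
        massAvoiding (a ∷ F) + Σ (allFin n) (λ i → Σ (allFin n) (above i))
                             + Σ (allFin n) (λ i → Σ (allFin n) (below i))
          ≡⟨ cong₂ (λ u v → massAvoiding (a ∷ F) + u + v) Σabove Σbelow ⟩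
        massAvoiding (a ∷ F) + Σ (allFin n) edgeAbove + Σ (allFin n) edgeBelow
          ≡⟨ trans (+-assoc (massAvoiding (a ∷ F)) _ _) (+-comm (massAvoiding (a ∷ F)) _) ⟩
        Σ (allFin n) edgeAbove + Σ (allFin n) edgeBelow + massAvoiding (a ∷ F)
          ≡⟨ cong (_+ massAvoiding (a ∷ F)) (sym degree≡) ⟩
        degreeAvoiding F a + massAvoiding (a ∷ F) ∎
        where
        open ≡-Reasoning
        rest above below : Fin n → Fin n → ℚ
        rest  i j = keepIf (i <ᵇ j ∧ live (a ∷ F) i ∧ live (a ∷ F) j) (μ ν i j)
        above i j = keepIf (does (i ≟ a)) (edgeAbove j)
        below i j = keepIf (does (j ≟ a)) (edgeBelow i)
        Σabove : Σ (allFin n) (λ i → Σ (allFin n) (above i)) ≡ Σ (allFin n) edgeAbove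
        Σabove = trans (Σ-cong (λ i → Σ-keepIf (does (i ≟ a)) edgeAbove (allFin n)) (allFin n))
                       (Σ-allFin-keepIf-≟ a (λ _ → Σ (allFin n) edgeAbove))
        Σbelow : Σ (allFin n) (λ i → Σ (allFin n) (below i)) ≡ Σ (allFin n) edgeBelow
        Σbelow = Σ-cong (λ i → Σ-allFin-keepIf-≟ a (λ _ → edgeBelow i)) (allFin n)
        degree≡ : degreeAvoiding F a ≡ Σ (allFin n) edgeAbove + Σ (allFin n) edgeBelow
        degree≡ = trans (Σ-cong degree-split (allFin n)) (Σ-+ edgeAbove edgeBelow (allFin n))

    pathPairs-suc-≤ : ∀ k s t F a b →
      (∀ c → fromℕ k ^ k * pathPairs (a ∷ F) s t c b ≤ massAvoiding (a ∷ F) ^ k) →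
      fromℕ k ^ k * pathPairs F (suc s) t a b ≤ degreeAvoiding F a * massAvoiding (a ∷ F) ^ k
    pathPairs-suc-≤ k s t F a b ih = begin
      Kᵏ * pathPairs F (suc s) t a b
        ≡⟨ cong (Kᵏ *_) (pathPairs-suc F s t a b) ⟩
      Kᵏ * Σ (allFin n) (λ c → μ ν a c * P c)
        ≡⟨ sym (Σ-*ˡ Kᵏ _ (allFin n)) ⟩
      Σ (allFin n) (λ c → Kᵏ * (μ ν a c * P c))
        ≡⟨ Σ-cong reorder (allFin n) ⟩
      Σ (allFin n) (λ c → w c * (Kᵏ * P c))
        ≤⟨ Σ-mono-≤ (λ c → *-monoˡ-≤-0≤ (w-nonNeg c) (ih c)) (allFin n) ⟩
      Σ (allFin n) (λ c → w c * massAvoiding (a ∷ F) ^ k)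
        ≡⟨ Σ-*ʳ (massAvoiding (a ∷ F) ^ k) w (allFin n) ⟩
      degreeAvoiding F a * massAvoiding (a ∷ F) ^ k ∎
      where
      open ≤-Reasoning
      Kᵏ = fromℕ k ^ k
      P w : Fin n → ℚ
      P c = pathPairs (a ∷ F) s t c b
      w c = keepIf (live (a ∷ F) c) (μ ν a c)
      w-nonNeg : ∀ c → 0ℚ ≤ w c
      w-nonNeg c = keepIf-nonNeg (live (a ∷ F) c) (nonneg ν a c)
      reorder : ∀ c → Kᵏ * (μ ν a c * P c) ≡ w c * (Kᵏ * P c)
      reorder c =
        trans (cong (Kᵏ *_) (pathPairs-live (a ∷ F) s t c b (μ ν a c))) (x∙yz≈y∙xz Kᵏ (w c) (P c))

    pathPairs-step : ∀ k s t F a b →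
      (∀ c → fromℕ k ^ k * pathPairs (a ∷ F) s t c b ≤ massAvoiding (a ∷ F) ^ k) →
      fromℕ (suc k) ^ suc k * pathPairs F (suc s) t a b ≤ massAvoiding F ^ suc k
    pathPairs-step k s t F a b ih with a ∈? F
    ... | yes a∈F = begin
      K₁ * pathPairs F (suc s) t a b  ≡⟨ cong (K₁ *_) (pathPairs-forbidden (suc s) t b a∈F) ⟩
      K₁ * 0ℚ                         ≡⟨ *-zeroʳ K₁ ⟩
      0ℚ                              ≤⟨ 0≤^ (suc k) (massAvoiding-nonNeg F) ⟩
      massAvoiding F ^ suc k          ∎
      where
      open ≤-Reasoning
      K₁ = fromℕ (suc k) ^ suc k
    ... | no a∉F = subst (λ M → fromℕ (suc k) ^ suc k * pathPairs F (suc s) t a b ≤ M ^ suc k)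
      (sym (massAvoiding-∷ a∉F))
      (amgm-≤ k (degreeAvoiding-nonNeg F a) (massAvoiding-nonNeg (a ∷ F)) (pathPairs-suc-≤ k s t F a b ih))

    pathPairs-0-0-≤1 : ∀ F a b → pathPairs F 0 0 a b ≤ 1ℚ
    pathPairs-0-0-≤1 F a b = single-≤1 (does (unique? (F ++ a ∷ b ∷ [])))
      where
      single-≤1 : ∀ u → keepIf u (1ℚ * 1ℚ) + 0ℚ + 0ℚ ≤ 1ℚ
      single-≤1 true  = ≤-refl
      single-≤1 false = nonNegative⁻¹ 1ℚ

    pathPairs-bound : ∀ k s t → s ℕ.+ t ≡ k → ∀ F a b →
                      fromℕ k ^ k * pathPairs F s t a b ≤ massAvoiding F ^ k
    pathPairs-bound zero zero zero refl F a b =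
      ≤-trans (≤-reflexive (*-identityˡ _)) (pathPairs-0-0-≤1 F a b)
    pathPairs-bound (suc k) (suc s) t s+t≡k F a b =
      pathPairs-step k s t F a b (λ c → pathPairs-bound k s t (ℕ.suc-injective s+t≡k) (a ∷ F) c b)
    pathPairs-bound (suc k) zero (suc t) t≡k F a b =
      subst (λ p → fromℕ (suc k) ^ suc k * p ≤ massAvoiding F ^ suc k) (sym (pathPairs-swap F zero (suc t) a b))
        (pathPairs-step k t zero F b a (λ c → pathPairs-bound k t zero t+0≡k (b ∷ F) c a))
      where
      t+0≡k : t ℕ.+ 0 ≡ k
      t+0≡k = trans (ℕ.+-identityʳ t) (ℕ.suc-injective t≡k)

    copyWeight : ∀ s t → Vec (Fin n) (suc s) → Vec (Fin n) (suc t) → ℚ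
    copyWeight s t P Q = keepIf (does (isCopy? s t P Q)) (pathWeight ν P * pathWeight ν Q)

    copyWeight-nonCopy : ∀ {s t} P Q → ¬ IsCopy s t P Q → copyWeight s t P Q ≡ 0ℚ
    copyWeight-nonCopy {s} {t} P Q ¬copy =
      cong (λ u → keepIf u (pathWeight ν P * pathWeight ν Q)) (dec-false (isCopy? s t P Q) ¬copy)

    copyWeight≡pairWeight : ∀ {s t} P Q → toℕ (head P) ≡ n ℕ.∸ 1 → toℕ (head Q) ≡ 0 →
                            copyWeight s t P Q ≡ pairWeight [] P Q
    copyWeight≡pairWeight {s} {t} P Q P-last Q-first =
      cong (λ u → keepIf u (pathWeight ν P * pathWeight ν Q))
           (does-⇔ (mk⇔ (proj₂ ∘ proj₂) (λ u → P-last , Q-first , u)) (isCopy? s t P Q) (unique? _))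

    βstar≡pathPairs : ∀ s t {a b} → toℕ a ≡ n ℕ.∸ 1 → toℕ b ≡ 0 →
                      βstar ν s t ≡ pathPairs [] s t a b
    βstar≡pathPairs s t {a} {b} a-last b-first = begin
      βstar ν s t
        ≡⟨ sumℚ-concatMap _ (allVecs n (suc s)) ⟩
      Σ (allVecs n (suc s)) (λ P → Σ Qs (copyWeight s t P))
        ≡⟨ Σ-allVecs-suc (λ P → Σ Qs (copyWeight s t P)) ⟩
      Σ (allFin n) (λ i → Σ Ps λ p → Σ Qs (copyWeight s t (i ∷ p)))
        ≡⟨ Σ-allFin-single a _ (λ i i≢a → Σ-zero (λ p → Σ-zero (notFromA i≢a p) Qs) Ps) ⟩
      Σ Ps (λ p → Σ Qs (copyWeight s t (a ∷ p)))
        ≡⟨ Σ-cong (λ p → Σ-allVecs-suc (copyWeight s t (a ∷ p))) Ps ⟩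
      Σ Ps (λ p → Σ (allFin n) λ j → Σ (allVecs n t) λ q → copyWeight s t (a ∷ p) (j ∷ q))
        ≡⟨ Σ-cong (λ p → Σ-allFin-single b _ (λ j j≢b → Σ-zero (notFromB j≢b p) (allVecs n t))) Ps ⟩
      Σ Ps (λ p → Σ (allVecs n t) λ q → copyWeight s t (a ∷ p) (b ∷ q))
        ≡⟨ Σ-cong (λ p → Σ-cong (λ q → copyWeight≡pairWeight (a ∷ p) (b ∷ q) a-last b-first) (allVecs n t)) Ps ⟩
      pathPairs [] s t a b ∎
      where
      open ≡-Reasoning
      Ps = allVecs n s
      Qs = allVecs n (suc t)
      notFromA : ∀ {i} → i ≢ a → ∀ p Q → copyWeight s t (i ∷ p) Q ≡ 0ℚ
      notFromA i≢a p Q =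
        copyWeight-nonCopy (_ ∷ p) Q (λ copy → i≢a (toℕ-injective (trans (proj₁ copy) (sym a-last))))
      notFromB : ∀ {j} → j ≢ b → ∀ p q → copyWeight s t (a ∷ p) (j ∷ q) ≡ 0ℚ
      notFromB j≢b p q =
        copyWeight-nonCopy (a ∷ p) (_ ∷ q)
          (λ copy → j≢b (toℕ-injective (trans (proj₁ (proj₂ copy)) (sym b-first))))

  βstar-bound : ∀ {n} (ν : Measure n) s t {k} → s ℕ.+ t ≡ k → mass ν ≡ 1ℚ →
                fromℕ (k ℕ.^ k) * βstar ν s t ≤ 1ℚ
  βstar-bound {zero}  ν s t {k} _ _ =
    ≤-trans (≤-reflexive (*-zeroʳ (fromℕ (k ℕ.^ k)))) (nonNegative⁻¹ 1ℚ)
  βstar-bound {suc n} ν s t {k} s+t≡k mass≡1 = begin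
    fromℕ (k ℕ.^ k) * βstar ν s t
      ≡⟨ cong₂ _*_ (fromℕ-^ k k) (βstar≡pathPairs ν s t (toℕ-fromℕ n) refl) ⟩
    fromℕ k ^ k * pathPairs ν [] s t (Fin.fromℕ n) Fin.zero
      ≤⟨ pathPairs-bound ν k s t s+t≡k [] _ _ ⟩
    massAvoiding ν [] ^ k
      ≡⟨ cong (_^ k) (trans (sym (mass≡massAvoiding[] ν)) mass≡1) ⟩
    1ℚ ^ k
      ≡⟨ 1^k≡1 k ⟩
    1ℚ ∎
    where open ≤-Reasoning

open import Data.Nat using (ℕ; _≤_; _∸_)
open import Data.Nat.Properties using (m+[n∸m]≡n)
open import Data.Rational using (1ℚ)
open import Relation.Binary.PropositionalEquality using (_≡_)
import Data.Rational

lemma2p5 : (ℓ m n : ℕ) → ℓ ≤ m → m ≤ n → (μ : Measure n) → mass μ ≡ 1ℚ →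
    Data.Rational._≤_ (βstar μ ℓ (m ∸ ℓ)) (invPowSelf m)
lemma2p5 ℓ m n ℓ≤m _ μ mass≡1 =
  fromℕ*≤1⇒≤1/ (m Data.Nat.^ m) {{powSelfNonZero m}}
    (βstar-bound μ ℓ (m ∸ ℓ) (m+[n∸m]≡n ℓ≤m) mass≡1)
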